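{- Let $G\in\mathcal{G}(\widehat{C}_6,\widehat{C}_7)$, let $x\in V(G)$, let $A$ be a connected component of $H_x[N_2(x)]$, and let $a,b$ be two adjacent vertices of $A$. If $|N(a)\cap N(x)|=2$, then every independent set $S\subseteq N_2(x)$ of $H_x$ which dominates $N(x)$ contains $a$.
   Context: Graphs are finite, simple, undirected. $\mathcal{G}(\widehat{C}_6,\widehat{C}_7)$ is the class of graphs containing no (not necessarily induced) subgraph isomorphic to $C_6$ or $C_7$. For a nonempty vertex set $S$, $N(S)$ (resp. $N[S]$) is the set of vertices at distance exactly $1$ (resp. at most $1$) from $S$; $N_2(x)$ (resp. $N_2[x]$) the set at distance exactly $2$ (resp. at most $2$) from $x$; $N[\emptyset]=\emptyset$. A set $S$ dominates $T$ if $T\subseteq N[S]$. Construction of $H_x$ (neighborhoods in $G$): let $A^*$ be the set of all connected components $A_0$ of $G[N_2(x)]$ for which some $a_0\in V(A_0)$ satisfies $N(x)\cap N(a_0)=N(x)\cap N(V(A_0))$, let $V(A^*)$ be the union of their vertex sets, and $H_x=G[N_2[x]\setminus N[V(A^*)]]$. In the claim itself, all neighborhoods $N(\cdot)$, $N[\cdot]$ and $N_2(x)$ are taken in the graph $H_x$. -}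

module Defs where

open import Data.Nat using (ℕ; zero; suc; _<?_; s≤s)
open import Data.Fin using (Fin; zero; suc; toℕ; fromℕ<)
open import Data.Fin.Subset using (Subset; _∈_)
open import Data.Product using (Σ; _×_; _,_)
open import Data.Sum using (_⊎_)
open import Relation.Nullary using (¬_; Dec; yes; no)
open import Relation.Binary.PropositionalEquality using (_≡_; _≢_)
open import Function.Definitions using (Injective)

record Graph : Set₁ where
  field
    n      : ℕ
    Adj    : Fin n → Fin n → Set
    Adj?   : ∀ u v → Dec (Adj u v)
    sym    : ∀ {u v} → Adj u v → Adj v u
    irrefl : ∀ {u} → ¬ Adj u u

cnext : ∀ {m} → Fin (suc m) → Fin (suc m)
cnext {m} i with toℕ i <? m
... | yes p = fromℕ< (s≤s p)
... | no _  = zero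

ExactlyTwo : ∀ {k} → (Fin k → Set) → Set
ExactlyTwo {k} P =
  Σ (Fin k) λ y₁ → Σ (Fin k) λ y₂ →
    y₁ ≢ y₂ × P y₁ × P y₂ × (∀ y → P y → y ≡ y₁ ⊎ y ≡ y₂)

module _ (G : Graph) where
  open Graph G

  -- G contains a (not necessarily induced) cycle of length suc m
  ContainsCycle : ℕ → Set
  ContainsCycle m =
    Σ (Fin (suc m) → Fin n) λ f →
      Injective _≡_ _≡_ f × (∀ i → Adj (f i) (f (cnext i)))

  C6C7free : Set
  C6C7free = ¬ ContainsCycle 5 × ¬ ContainsCycle 6

  data Reach (P : Fin n → Set) : Fin n → Fin n → Set where
    here : ∀ {u} → P u → Reach P u u
    step : ∀ {u v w} → P u → Adj u v → Reach P v w → Reach P u w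

  IsComponent : (P : Fin n → Set) → (Fin n → Set) → Set
  IsComponent P A =
    Σ (Fin n) λ r → P r × (∀ v → (A v → Reach P r v) × (Reach P r v → A v))

  module Hx (x : Fin n) where
    N2G : Fin n → Set
    N2G y = y ≢ x × ¬ Adj x y × Σ (Fin n) λ w → Adj x w × Adj w y

    -- v ∈ V(A*): the component A₀ of G[N_2(x)] containing v has some a₀
    -- with N(x) ∩ N(V(A₀)) ⊆ N(x) ∩ N(a₀) (the reverse inclusion is automatic)
    InAstar : Fin n → Set
    InAstar v = N2G v × Σ (Fin n) λ a₀ → Reach N2G v a₀ ×
      (∀ y → Adj x y → (Σ (Fin n) λ w → Reach N2G v w × Adj w y) → Adj a₀ y)

    NclAstar : Fin n → Set
    NclAstar v = InAstar v ⊎ Σ (Fin n) λ u → InAstar u × Adj u v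

    N2clG : Fin n → Set
    N2clG v = v ≡ x ⊎ Adj x v ⊎ N2G v

    VH : Fin n → Set
    VH v = N2clG v × ¬ NclAstar v

    HAdj : Fin n → Fin n → Set
    HAdj u v = VH u × VH v × Adj u v

    N2H : Fin n → Set
    N2H y = VH y × y ≢ x × ¬ HAdj x y × Σ (Fin n) λ w → HAdj x w × HAdj w y

    GoodSet : Subset n → Set
    GoodSet S =
      (∀ v → v ∈ S → N2H v) ×
      (∀ u v → u ∈ S → v ∈ S → ¬ HAdj u v) ×
      (∀ y → HAdj x y → y ∈ S ⊎ Σ (Fin n) λ s → s ∈ S × HAdj s y)

module Submission where

-- Corollary 3: in a C₆- and C₇-free graph G, fix x and write N₁ = N(x) and
-- N₂ = N₂(x), both taken in G.  Call v ∈ N₂ *residual* if v ∉ V(A*); every vertex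
-- of N₂(x) in H_x is residual, because H_x omits N[V(A*)].  Every contradiction
-- below is an explicit 6- or 7-cycle (hexagon, heptagon).
--   (1) Shortcut: if v reaches w inside G[N₂] and w ∼ y ∈ N₁, then y is adjacent
--       to v or to an N₂-neighbour of v; otherwise a C₆ through x appears.
--   (2) Detours: a residual v does not witness A* for its own component, so by (1)
--       some y ∈ N₁ with v ≁ y is reached as v ∼ c ∼ y with c ∈ N₂.
--   (3) A detour of s, compared with a vertex a sharing an exit with s, either
--       passes through a or ends at the other exit of a; else it closes a C₇.
--   (4) Hence two distinct residual vertices share at most one neighbour in N₁, and
--   (5) two exits y₁ ≠ y₂ of a residual a cannot be dominated by non-adjacent
--       residual vertices s₁, s₂ ≠ a (the case s₁ ≁ y₂, s₂ ≁ y₁ needs a second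
--       look at how the detours of s₁ and s₂ escape).
-- The corollary follows: if a ∉ S, domination of y₁, y₂ by S contradicts (5).

open import Defs
open import Data.Fin using (Fin; zero; suc)
open import Data.Fin.Subset using (Subset; _∈_)
open import Data.Fin.Subset.Properties using (_∈?_)
open import Data.Fin.Properties using (_≟_)
open import Data.Vec using ([]; _∷_; lookup)
open import Data.Vec.Relation.Unary.All using ([]; _∷_)
open import Data.Vec.Relation.Unary.AllPairs using ([]; _∷_)
open import Data.Vec.Relation.Unary.Unique.Propositional using (Unique)
open import Data.Vec.Relation.Unary.Unique.Propositional.Properties using (lookup-injective)
open import Data.Product using (_×_; Σ; _,_; proj₁; proj₂)
open import Data.Sum using (_⊎_; inj₁; inj₂)
open import Data.Empty using (⊥; ⊥-elim)
open import Relation.Nullary using (¬_; yes; no)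
open import Relation.Binary.PropositionalEquality using (_≢_; refl; ≢-sym)

module Cycles (G : Graph) where
  open Graph G

  hexagon : ∀ {v₀ v₁ v₂ v₃ v₄ v₅} → Unique (v₀ ∷ v₁ ∷ v₂ ∷ v₃ ∷ v₄ ∷ v₅ ∷ []) →
    Adj v₀ v₁ → Adj v₁ v₂ → Adj v₂ v₃ → Adj v₃ v₄ → Adj v₄ v₅ → Adj v₅ v₀ →
    ContainsCycle G 5
  hexagon {v₀} {v₁} {v₂} {v₃} {v₄} {v₅} distinct e₀ e₁ e₂ e₃ e₄ e₅ =
    lookup vs , (λ {i} {j} → lookup-injective distinct i j) , edge
    where
    vs = v₀ ∷ v₁ ∷ v₂ ∷ v₃ ∷ v₄ ∷ v₅ ∷ []
    edge : ∀ i → Adj (lookup vs i) (lookup vs (cnext i))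
    edge zero = e₀
    edge (suc zero) = e₁
    edge (suc (suc zero)) = e₂
    edge (suc (suc (suc zero))) = e₃
    edge (suc (suc (suc (suc zero)))) = e₄
    edge (suc (suc (suc (suc (suc zero))))) = e₅

  heptagon : ∀ {v₀ v₁ v₂ v₃ v₄ v₅ v₆} → Unique (v₀ ∷ v₁ ∷ v₂ ∷ v₃ ∷ v₄ ∷ v₅ ∷ v₆ ∷ []) →
    Adj v₀ v₁ → Adj v₁ v₂ → Adj v₂ v₃ → Adj v₃ v₄ → Adj v₄ v₅ → Adj v₅ v₆ → Adj v₆ v₀ →
    ContainsCycle G 6
  heptagon {v₀} {v₁} {v₂} {v₃} {v₄} {v₅} {v₆} distinct e₀ e₁ e₂ e₃ e₄ e₅ e₆ =
    lookup vs , (λ {i} {j} → lookup-injective distinct i j) , edge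
    where
    vs = v₀ ∷ v₁ ∷ v₂ ∷ v₃ ∷ v₄ ∷ v₅ ∷ v₆ ∷ []
    edge : ∀ i → Adj (lookup vs i) (lookup vs (cnext i))
    edge zero = e₀
    edge (suc zero) = e₁
    edge (suc (suc zero)) = e₂
    edge (suc (suc (suc zero))) = e₃
    edge (suc (suc (suc (suc zero)))) = e₄
    edge (suc (suc (suc (suc (suc zero))))) = e₅
    edge (suc (suc (suc (suc (suc (suc zero)))))) = e₆

module Walks (G : Graph) where
  open Graph G

  reach-start : ∀ {P u w} → Reach G P u w → P u
  reach-start (here pu) = pu
  reach-start (step pu _ _) = pu

  reach-end : ∀ {P u w} → Reach G P u w → P w
  reach-end (here pw) = pw
  reach-end (step _ _ r) = reach-end r

  reach-trans : ∀ {P u v w} → Reach G P u v → Reach G P v w → Reach G P u w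
  reach-trans (here _) r = r
  reach-trans (step pu e r) r' = step pu e (reach-trans r r')

module AroundVertex (G : Graph) (free : C6C7free G) (x : Fin (Graph.n G)) where
  open Graph G
  open Hx G x
  open Cycles G
  open Walks G

  V : Set
  V = Fin n

  adj⇒≢ : ∀ {u v} → Adj u v → u ≢ v
  adj⇒≢ uv refl = irrefl uv

  separated : ∀ {u y y'} → Adj u y → ¬ Adj u y' → y ≢ y'
  separated uy ¬uy' refl = ¬uy' uy

  unlike : ∀ {u v y} → Adj u y → ¬ Adj v y → u ≢ v
  unlike uy ¬vy refl = ¬vy uy

  x≢N₂ : ∀ {v} → N2G v → x ≢ v
  x≢N₂ nv = ≢-sym (proj₁ nv)

  N₁≢N₂ : ∀ {y v} → Adj x y → N2G v → y ≢ v
  N₁≢N₂ xy nv refl = proj₁ (proj₂ nv) xy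

  N₂≢N₁ : ∀ {v y} → N2G v → Adj x y → v ≢ y
  N₂≢N₁ nv xy = ≢-sym (N₁≢N₂ xy nv)

  -- Inductive step: if u ∼ u' and u' ∼ c ∼ y, but u ≁ y,
  -- then with a common neighbour z of x and u, x z u u' c y is a C₆.
  shortcut : ∀ {v w y} → Reach G N2G v w → Adj w y → Adj x y →
    Adj v y ⊎ Σ V λ c → N2G c × Adj v c × Adj c y
  shortcut (here _) wy xy = inj₁ wy
  shortcut {y = y} (step {u} {u'} nu uu' r) wy xy with shortcut r wy xy | Adj? u y
  ... | _ | yes uy = inj₁ uy
  ... | inj₁ u'y | no _ = inj₂ (u' , reach-start r , uu' , u'y)
  ... | inj₂ (c , nc , u'c , cy) | no ¬uy with nu
  ...   | _ , _ , z , xz , zu = ⊥-elim (proj₁ free (hexagon distinct xz zu uu' u'c cy (sym xy)))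
    where
    nu' : N2G u'
    nu' = reach-start r
    distinct : Unique (x ∷ z ∷ u ∷ u' ∷ c ∷ y ∷ [])
    distinct =
      (adj⇒≢ xz ∷ x≢N₂ nu ∷ x≢N₂ nu' ∷ x≢N₂ nc ∷ adj⇒≢ xy ∷ [])
      ∷ (N₁≢N₂ xz nu ∷ N₁≢N₂ xz nu' ∷ N₁≢N₂ xz nc ∷ separated (sym zu) ¬uy ∷ [])
      ∷ (adj⇒≢ uu' ∷ ≢-sym (unlike cy ¬uy) ∷ N₂≢N₁ nu xy ∷ [])
      ∷ (adj⇒≢ u'c ∷ N₂≢N₁ nu' xy ∷ [])
      ∷ (N₂≢N₁ nc xy ∷ [])
      ∷ [] ∷ []

  Residual : V → Set
  Residual v = N2G v × ¬ InAstar v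

  record Detour (v : V) : Set where
    constructor detour
    field
      exit     : V
      via      : V
      x∼exit   : Adj x exit
      via∈N₂   : N2G via
      v∼via    : Adj v via
      via∼exit : Adj via exit
      v≁exit   : ¬ Adj v exit

  -- (2) Without a detour, v itself would be the vertex a₀ putting its component into A*.
  residual-detour : ∀ {v} → Residual v → ¬ ¬ Detour v
  residual-detour {v} (nv , v∉A*) no-detour = v∉A* (nv , v , here nv , sees-all-exits)
    where
    sees-all-exits : ∀ y → Adj x y → (Σ V λ w → Reach G N2G v w × Adj w y) → Adj v y
    sees-all-exits y xy (w , r , wy) with Adj? v y | shortcut r wy xy
    ... | yes vy | _ = vy
    ... | no _ | inj₁ vy = vy
    ... | no ¬vy | inj₂ (c , nc , vc , cy) = ⊥-elim (no-detour (detour y c xy nc vc cy ¬vy))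

  -- Residuality depends only on the component of G[N₂], so it passes along N₂-edges.
  residual-step : ∀ {v c} → Residual v → Adj v c → N2G c → Residual c
  residual-step (nv , v∉A*) vc nc = nc , λ { (_ , a₀ , r , a₀-sees) →
    v∉A* (nv , a₀ , step nv vc r , λ y xy → λ { (w , r' , wy) →
      a₀-sees y xy (w , reach-trans (step nc (sym vc) (here nv)) r' , wy) }) }

  -- How a detour of s avoids closing a C₇ with a vertex a that shares an exit with s
  -- and has a second exit z: it passes through a, or ends at z through some d ≠ a.
  data Escape (s a z : V) : Set where
    via-partner : ∀ y → Adj x y → Adj s a → Adj a y → ¬ Adj s y → Escape s a z
    via-other   : ∀ d → N2G d → d ≢ a → Adj s d → Adj d z → ¬ Adj s z → Escape s a z

  -- (3) Otherwise the detour (y', d) of s gives the C₇  x y' d s y a z.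
  detour-escape : ∀ {s a y z} → N2G s → N2G a → s ≢ a → y ≢ z → Adj x y → Adj x z →
    Adj s y → Adj a y → Adj a z → Detour s → Escape s a z
  detour-escape {s} {a} {y} {z} ns na s≢a y≢z xy xz sy ay az (detour y' d xy' nd sd dy' ¬sy')
    with d ≟ a | y' ≟ z
  ... | yes refl | _ = via-partner y' xy' sd dy' ¬sy'
  ... | no d≢a | yes refl = via-other d nd d≢a sd dy' ¬sy'
  ... | no d≢a | no y'≢z =
    ⊥-elim (proj₂ free (heptagon distinct xy' (sym dy') (sym sd) sy (sym ay) az (sym xz)))
    where
    distinct : Unique (x ∷ y' ∷ d ∷ s ∷ y ∷ a ∷ z ∷ [])
    distinct =
      (adj⇒≢ xy' ∷ x≢N₂ nd ∷ x≢N₂ ns ∷ adj⇒≢ xy ∷ x≢N₂ na ∷ adj⇒≢ xz ∷ [])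
      ∷ (N₁≢N₂ xy' nd ∷ N₁≢N₂ xy' ns ∷ ≢-sym (separated sy ¬sy') ∷ N₁≢N₂ xy' na ∷ y'≢z ∷ [])
      ∷ (≢-sym (adj⇒≢ sd) ∷ N₂≢N₁ nd xy ∷ d≢a ∷ N₂≢N₁ nd xz ∷ [])
      ∷ (N₂≢N₁ ns xy ∷ s≢a ∷ N₂≢N₁ ns xz ∷ [])
      ∷ (N₁≢N₂ xy na ∷ y≢z ∷ [])
      ∷ (N₂≢N₁ na xz ∷ [])
      ∷ [] ∷ []

  -- (4) Two distinct residual vertices a, s share at most one neighbour in N₁: both
  -- detours must pass through the other vertex, giving the C₆  x y' a y₁ s y.
  at-most-one-common-exit : ∀ {a s y₁ y₂} → Residual a → Residual s → a ≢ s → y₁ ≢ y₂ →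
    Adj x y₁ → Adj x y₂ → Adj a y₁ → Adj a y₂ → Adj s y₁ → Adj s y₂ → ⊥
  at-most-one-common-exit {a} {s} {y₁} {y₂} ra@(na , _) rs@(ns , _) a≢s y₁≢y₂
    xy₁ xy₂ ay₁ ay₂ sy₁ sy₂ =
    residual-detour ra λ Da → residual-detour rs λ Ds →
      close (detour-escape na ns a≢s y₁≢y₂ xy₁ xy₂ ay₁ sy₁ sy₂ Da)
            (detour-escape ns na (≢-sym a≢s) y₁≢y₂ xy₁ xy₂ sy₁ ay₁ ay₂ Ds)
    where
    close : Escape a s y₂ → Escape s a y₂ → ⊥
    close (via-other _ _ _ _ _ ¬ay₂) _ = ¬ay₂ ay₂
    close _ (via-other _ _ _ _ _ ¬sy₂) = ¬sy₂ sy₂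
    close (via-partner y xy _ sy ¬ay) (via-partner y' xy' _ ay' ¬sy') =
      proj₁ free (hexagon distinct xy' (sym ay') ay₁ (sym sy₁) sy (sym xy))
      where
      distinct : Unique (x ∷ y' ∷ a ∷ y₁ ∷ s ∷ y ∷ [])
      distinct =
        (adj⇒≢ xy' ∷ x≢N₂ na ∷ adj⇒≢ xy₁ ∷ x≢N₂ ns ∷ adj⇒≢ xy ∷ [])
        ∷ (N₁≢N₂ xy' na ∷ ≢-sym (separated sy₁ ¬sy') ∷ N₁≢N₂ xy' ns ∷ separated ay' ¬ay ∷ [])
        ∷ (N₂≢N₁ na xy₁ ∷ a≢s ∷ N₂≢N₁ na xy ∷ [])
        ∷ (N₁≢N₂ xy₁ ns ∷ separated ay₁ ¬ay ∷ [])
        ∷ (N₂≢N₁ ns xy ∷ [])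
        ∷ [] ∷ []

  -- The C₆  s a z t d y  arising when one dominator s escapes through a and the
  -- other dominator t escapes through d ≠ a.
  crossed-hexagon : ∀ {s a t d y z} → N2G s → N2G a → N2G t → N2G d → Adj x y → Adj x z →
    s ≢ a → t ≢ a → d ≢ a → y ≢ z → ¬ Adj s t → ¬ Adj s z →
    Adj s a → Adj a z → Adj t z → Adj t d → Adj d y → Adj s y → ⊥
  crossed-hexagon {s} {a} {t} {d} {y} {z} ns na nt nd xy xz s≢a t≢a d≢a y≢z ¬st ¬sz
    sa az tz td dy sy = proj₁ free (hexagon distinct sa az (sym tz) td dy (sym sy))
    where
    distinct : Unique (s ∷ a ∷ z ∷ t ∷ d ∷ y ∷ [])
    distinct =
      (s≢a ∷ N₂≢N₁ ns xz ∷ ≢-sym (unlike tz ¬sz) ∷ ≢-sym (unlike (sym td) ¬st) ∷ N₂≢N₁ ns xy ∷ [])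
      ∷ (N₂≢N₁ na xz ∷ ≢-sym t≢a ∷ ≢-sym d≢a ∷ N₂≢N₁ na xy ∷ [])
      ∷ (N₁≢N₂ xz nt ∷ N₁≢N₂ xz nd ∷ ≢-sym y≢z ∷ [])
      ∷ (adj⇒≢ td ∷ N₂≢N₁ nt xy ∷ [])
      ∷ (N₂≢N₁ nd xy ∷ [])
      ∷ [] ∷ []

  -- Each detour escapes through a or into the other exit; every combination
  -- closes a C₆ or makes the escape vertex share both exits with a, against (4).
  crossed-domination : ∀ {a s₁ s₂ y₁ y₂} → Residual a → Residual s₁ → Residual s₂ →
    s₁ ≢ a → s₂ ≢ a → ¬ Adj s₁ s₂ → y₁ ≢ y₂ → Adj x y₁ → Adj x y₂ →
    Adj a y₁ → Adj a y₂ → Adj s₁ y₁ → Adj s₂ y₂ → ¬ Adj s₁ y₂ → ¬ Adj s₂ y₁ → ⊥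
  crossed-domination {a} {s₁} {s₂} {y₁} {y₂} ra@(na , _) r₁@(n₁ , _) r₂@(n₂ , _)
    s₁≢a s₂≢a ¬s₁s₂ y₁≢y₂ xy₁ xy₂ ay₁ ay₂ s₁y₁ s₂y₂ ¬s₁y₂ ¬s₂y₁ =
    residual-detour r₁ λ D₁ → residual-detour r₂ λ D₂ →
      close (detour-escape n₁ na s₁≢a y₁≢y₂ xy₁ xy₂ s₁y₁ ay₁ ay₂ D₁)
            (detour-escape n₂ na s₂≢a (≢-sym y₁≢y₂) xy₂ xy₁ s₂y₂ ay₂ ay₁ D₂)
    where
    ¬s₂s₁ : ¬ Adj s₂ s₁
    ¬s₂s₁ s₂s₁ = ¬s₁s₂ (sym s₂s₁)
    s₁≢s₂ : s₁ ≢ s₂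
    s₁≢s₂ = unlike s₁y₁ ¬s₂y₁
    close : Escape s₁ a y₂ → Escape s₂ a y₁ → ⊥
    close (via-partner _ _ s₁a _ _) (via-partner _ _ s₂a _ _) =
      proj₁ free (hexagon distinct xy₁ (sym s₁y₁) s₁a (sym s₂a) s₂y₂ (sym xy₂))
      where
      distinct : Unique (x ∷ y₁ ∷ s₁ ∷ a ∷ s₂ ∷ y₂ ∷ [])
      distinct =
        (adj⇒≢ xy₁ ∷ x≢N₂ n₁ ∷ x≢N₂ na ∷ x≢N₂ n₂ ∷ adj⇒≢ xy₂ ∷ [])
        ∷ (N₁≢N₂ xy₁ n₁ ∷ N₁≢N₂ xy₁ na ∷ N₁≢N₂ xy₁ n₂ ∷ y₁≢y₂ ∷ [])
        ∷ (s₁≢a ∷ s₁≢s₂ ∷ N₂≢N₁ n₁ xy₂ ∷ [])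
        ∷ (≢-sym s₂≢a ∷ N₂≢N₁ na xy₂ ∷ [])
        ∷ (N₂≢N₁ n₂ xy₂ ∷ [])
        ∷ [] ∷ []
    close (via-partner _ _ s₁a _ _) (via-other d₂ nd₂ d₂≢a s₂d₂ d₂y₁ _) =
      crossed-hexagon n₁ na n₂ nd₂ xy₁ xy₂ s₁≢a s₂≢a d₂≢a y₁≢y₂ ¬s₁s₂ ¬s₁y₂
        s₁a ay₂ s₂y₂ s₂d₂ d₂y₁ s₁y₁
    close (via-other d₁ nd₁ d₁≢a s₁d₁ d₁y₂ _) (via-partner _ _ s₂a _ _) =
      crossed-hexagon n₂ na n₁ nd₁ xy₂ xy₁ s₂≢a s₁≢a d₁≢a (≢-sym y₁≢y₂) ¬s₂s₁ ¬s₂y₁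
        s₂a ay₁ s₁y₁ s₁d₁ d₁y₂ s₂y₂
    close (via-other d₁ nd₁ d₁≢a s₁d₁ d₁y₂ _) (via-other d₂ nd₂ _ s₂d₂ d₂y₁ _) with d₁ ≟ d₂
    ... | yes refl = at-most-one-common-exit ra (residual-step r₁ s₁d₁ nd₁) (≢-sym d₁≢a)
          y₁≢y₂ xy₁ xy₂ ay₁ ay₂ d₂y₁ d₁y₂
    ... | no d₁≢d₂ =
      proj₁ free (hexagon distinct (sym s₁y₁) s₁d₁ d₁y₂ (sym s₂y₂) s₂d₂ d₂y₁)
      where
      distinct : Unique (y₁ ∷ s₁ ∷ d₁ ∷ y₂ ∷ s₂ ∷ d₂ ∷ [])
      distinct =
        (N₁≢N₂ xy₁ n₁ ∷ N₁≢N₂ xy₁ nd₁ ∷ y₁≢y₂ ∷ N₁≢N₂ xy₁ n₂ ∷ N₁≢N₂ xy₁ nd₂ ∷ [])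
        ∷ (adj⇒≢ s₁d₁ ∷ N₂≢N₁ n₁ xy₂ ∷ s₁≢s₂ ∷ ≢-sym (unlike (sym s₂d₂) ¬s₁s₂) ∷ [])
        ∷ (N₂≢N₁ nd₁ xy₂ ∷ unlike (sym s₁d₁) ¬s₂s₁ ∷ d₁≢d₂ ∷ [])
        ∷ (N₁≢N₂ xy₂ n₂ ∷ N₁≢N₂ xy₂ nd₂ ∷ [])
        ∷ (adj⇒≢ s₂d₂ ∷ [])
        ∷ [] ∷ []

  dominated-exits : ∀ {a s₁ s₂ y₁ y₂} → Residual a → Residual s₁ → Residual s₂ →
    s₁ ≢ a → s₂ ≢ a → ¬ Adj s₁ s₂ → y₁ ≢ y₂ → Adj x y₁ → Adj x y₂ →
    Adj a y₁ → Adj a y₂ → Adj s₁ y₁ → Adj s₂ y₂ → ⊥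
  dominated-exits {s₁ = s₁} {s₂} {y₁} {y₂} ra r₁ r₂ s₁≢a s₂≢a ¬s₁s₂ y₁≢y₂ xy₁ xy₂ ay₁ ay₂
    s₁y₁ s₂y₂ with Adj? s₁ y₂ | Adj? s₂ y₁
  ... | yes s₁y₂ | _ =
    at-most-one-common-exit ra r₁ (≢-sym s₁≢a) y₁≢y₂ xy₁ xy₂ ay₁ ay₂ s₁y₁ s₁y₂
  ... | no _ | yes s₂y₁ =
    at-most-one-common-exit ra r₂ (≢-sym s₂≢a) y₁≢y₂ xy₁ xy₂ ay₁ ay₂ s₂y₁ s₂y₂
  ... | no ¬s₁y₂ | no ¬s₂y₁ =
    crossed-domination ra r₁ r₂ s₁≢a s₂≢a ¬s₁s₂ y₁≢y₂ xy₁ xy₂ ay₁ ay₂ s₁y₁ s₂y₂ ¬s₁y₂ ¬s₂y₁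

  -- Vertices of N₂(x) in H_x are residual vertices of G: H_x omits V(A*).
  N₂ᴴ⇒residual : ∀ {v} → N2H v → Residual v
  N₂ᴴ⇒residual (vh , v≢x , ¬hxv , w , (xh , _ , xw) , (_ , _ , wv)) =
    (v≢x , (λ xv → ¬hxv (xh , vh , xv)) , w , xw , wv) , λ v∈A* → proj₂ vh (inj₁ v∈A*)

  good-set-contains : ∀ {a y₁ y₂} (S : Subset n) → GoodSet S → N2H a → y₁ ≢ y₂ →
    HAdj a y₁ → HAdj x y₁ → HAdj a y₂ → HAdj x y₂ → a ∈ S
  good-set-contains {a} {y₁} {y₂} S (S⊆N₂ , independent , dominating) na y₁≢y₂
    (_ , _ , ay₁) hxy₁ (_ , _ , ay₂) hxy₂ with a ∈? S
  ... | yes a∈S = a∈S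
  ... | no a∉S = ⊥-elim (dominators (dominating y₁ hxy₁) (dominating y₂ hxy₂))
    where
    Dominated : V → Set
    Dominated y = y ∈ S ⊎ Σ V λ s → s ∈ S × HAdj s y
    -- The exits y₁, y₂ are H_x-neighbours of x, hence not in S ⊆ N₂(x).
    dominators : Dominated y₁ → Dominated y₂ → ⊥
    dominators (inj₁ y₁∈S) _ = proj₁ (proj₂ (proj₂ (S⊆N₂ y₁ y₁∈S))) hxy₁
    dominators _ (inj₁ y₂∈S) = proj₁ (proj₂ (proj₂ (S⊆N₂ y₂ y₂∈S))) hxy₂
    dominators (inj₂ (s₁ , s₁∈S , _ , _ , s₁y₁)) (inj₂ (s₂ , s₂∈S , _ , _ , s₂y₂)) =
      dominated-exits (N₂ᴴ⇒residual na) (N₂ᴴ⇒residual (S⊆N₂ s₁ s₁∈S))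
        (N₂ᴴ⇒residual (S⊆N₂ s₂ s₂∈S)) (λ { refl → a∉S s₁∈S }) (λ { refl → a∉S s₂∈S })
        (λ s₁s₂ → independent s₁ s₂ s₁∈S s₂∈S
          (proj₁ (S⊆N₂ s₁ s₁∈S) , proj₁ (S⊆N₂ s₂ s₂∈S) , s₁s₂))
        y₁≢y₂ (proj₂ (proj₂ hxy₁)) (proj₂ (proj₂ hxy₂)) ay₁ ay₂ s₁y₁ s₂y₂

corollary3 : (G : Graph) → C6C7free G → (x : Fin (Graph.n G)) →
    (A : Fin (Graph.n G) → Set) → IsComponent G (Hx.N2H G x) A →
    (a b : Fin (Graph.n G)) → A a → A b → Hx.HAdj G x a b →
    ExactlyTwo (λ y → Hx.HAdj G x a y × Hx.HAdj G x x y) →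
    (S : Subset (Graph.n G)) → Hx.GoodSet G x S → a ∈ S
corollary3 G free x A (_ , _ , component) a _ a∈A _ _
  (_ , _ , y₁≢y₂ , (ay₁ , xy₁) , (ay₂ , xy₂) , _) S good =
  good-set-contains S good a∈N₂ y₁≢y₂ ay₁ xy₁ ay₂ xy₂
  where
  open AroundVertex G free x
  open Walks G
  a∈N₂ : Hx.N2H G x a
  a∈N₂ = reach-end (proj₁ (component a) a∈A)
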